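{- Let $A$ be a partial combinatory algebra over $\omega$ with its ${\Pi}{\Sigma}\mathrm{I}$ (respectively ${\Pi}{\Sigma}\mathrm{W}\mathrm{I}$) type structure. Let $\sigma\sim\tau$ and let $i,j\in A$ satisfy $i\approx_\sigma j$, i.e. $ia\sim jb$ whenever $a\sim_\sigma b$. Then $X_\sigma=X_\tau$ and $F_{\sigma,i}=F_{\tau,j}$.
   Context: Work in ${\sf CZF}$ (${\sf CZF}+{\sf REA}$ for ${\Pi}{\Sigma}\mathrm{W}\mathrm{I}$). Pca over $\omega$: set $A$ with at least two elements, partial application $ab$ (left-associated), $\mathbf k,\mathbf s$ with $\mathbf kab\simeq a$, $\mathbf sab\downarrow$, $\mathbf sabc\simeq ac(bc)$; numerals $n\mapsto\bar n$ and $\mathbf{succ},\mathbf{pred},\mathbf d$ with $\mathbf{succ}\,\bar n=\overline{n+1}$, $\mathbf{pred}\,\overline{n+1}=\bar n$, $\mathbf d\bar n\bar mab\simeq a$ if $n=m$ else $b$; $\mathbf0=\bar0,\mathbf1=\bar1$; pairing $\mathbf p,\mathbf p_0,\mathbf p_1$ with $\mathbf p_i(\mathbf pa_0a_1)=a_i$, $a_i:=\mathbf p_ia$. Type codes ${\sf N}_n=\mathbf p\bar0\bar n$, ${\sf N}=\mathbf p\bar1\mathbf0$, ${\Pi}_ab=\mathbf p\bar2(\mathbf pab)$, ${\Sigma}_ab=\mathbf p\bar3(\mathbf pab)$, $\mathrm{I}_c(a,b)=\mathbf p\bar4(\mathbf pc(\mathbf pab))$, $\mathrm{W}_ab=\mathbf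 p\bar5(\mathbf pab)$. Type structure (simultaneous inductive definition of $\sim$ and $\sim_\sigma$): ${\sf N}_n\sim{\sf N}_n$, $a\sim_{{\sf N}_n}b$ iff $a=b=\bar m$, $m<n$; ${\sf N}\sim{\sf N}$, $a\sim_{\sf N}b$ iff $a=b=\bar n$; if $\sigma\sim\tau$ and ($a\sim_\sigma b\Rightarrow ia\sim jb$) then ${\Pi}_\sigma i\sim{\Pi}_\tau j$ with $f\sim_{{\Pi}_\sigma i}g$ iff ($a\sim_\sigma b\Rightarrow fa\sim_{ia}gb$), and ${\Sigma}_\sigma i\sim{\Sigma}_\tau j$ with $a\sim_{{\Sigma}_\sigma i}b$ iff $a_0\sim_\sigma b_0$ and $a_1\sim_{ia_0}b_1$; if $\sigma\sim\tau$, $a\sim_\sigma\breve a$, $b\sim_\sigma\breve b$ then $\mathrm{I}_\sigma(a,b)\sim\mathrm{I}_\tau(\breve a,\breve b)$ with $c\sim_{\mathrm{I}_\sigma(a,b)}d$ iff $c=d=\mathbf0$ and $a\sim_\sigma b$; for ${\Pi}{\Sigma}\mathrm{W}\mathrm{I}$ also: if $\sigma\sim\tau$ and ($a\sim_\sigma b\Rightarrow ia\sim jb$) then $\mathrm{W}_\sigma i\sim\mathrm{W}_\tau j$ with $\sim_{\mathrm{W}_\sigma i}$ the least relation such that $c\sim d$ whenever $c_0\sim_\sigma d_0$ and $c_1p\sim d_1q$ for all $p\sim_{ic_0}q$. $\sigma$ is a type if $\sigma\sim\sigma$; $a$ has type $\sigma$ if $a\sim_\sigma a$; $i$ is a family of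 types over $\sigma$ if $a\sim_\sigma b$ implies $ia\sim ib$. $\mathrm{V_{ext}}(A)$ is the least class with $x\in\mathrm{V_{ext}}(A)$ whenever $x\subseteq A\times A\times\mathrm{V_{ext}}(A)$. Internal pairing: $\{x\}_A=\{\langle\mathbf0,\mathbf0,x\rangle\}$, $\{x,y\}_A=\{\langle\mathbf0,\mathbf0,x\rangle,\langle\mathbf1,\mathbf1,y\rangle\}$, $\langle x,y\rangle_A=\{\langle\mathbf0,\mathbf0,\{x\}_A\rangle,\langle\mathbf1,\mathbf1,\{x,y\}_A\rangle\}$. $\dot n=\{\langle\bar m,\bar m,\dot m\rangle\mid m<n\}$. For $a$ of type $\sigma$, $a^\sigma$: if $\sigma\in\{{\sf N}_n,{\sf N}\}$ and $a=\bar m$, $a^\sigma=\dot m$; $f^{{\Pi}_\sigma i}=\{\langle a,b,\langle a^\sigma,(fa)^{ia}\rangle_A\rangle\mid a\sim_\sigma b\}$; $a^{{\Sigma}_\sigma i}=\langle a_0^\sigma,a_1^{ia_0}\rangle_A$; $c^{\mathrm{I}_\sigma(a,b)}=0$; $c^{\mathrm{W}_\sigma i}=\langle c_0^\sigma,\{\langle p,q,\langle p^{ic_0},(c_1p)^{\mathrm{W}_\sigma i}\rangle_A\rangle\mid p\sim_{ic_0}q\}\rangle_A$. For a type $\sigma$ and family $i$ of types over $\sigma$: $X_\sigma=\{\langle a,b,a^\sigma\rangle\mid a\sim_\sigma b\}$ and $F_{\sigma,i}=\{\langle a,b,\langle a^\sigma,X_{ia}\rangle_A\rangle\mid a\sim_\sigma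 b\}$. -}

module Defs where

open import Data.Nat using (ℕ; zero; suc; _<_)
open import Data.Nat.Induction using (<-rec)
open import Data.Bool using (Bool; true; false; T)
open import Data.Unit using (⊤; tt)
open import Data.Empty using (⊥; ⊥-elim)
open import Data.Product using (Σ; ∃; _×_; _,_; proj₁; proj₂)
open import Relation.Nullary using (¬_)
open import Relation.Binary.PropositionalEquality using (_≡_; _≢_)
open import Function.Bundles using (_⇔_)

-- Partial combinatory algebras over ω.
-- Partial application is a functional ternary relation:
--   App f x v  means  "f x is defined and equals v".

record PCA : Set₁ where
  field
    A        : Set
    App      : A → A → A → Set
    App-func : ∀ {f x v w} → App f x v → App f x w → v ≡ w

  App2 : A → A → A → A → Set
  App2 f x y v = Σ A λ u → App f x u × App u y v

  App3 : A → A → A → A → A → Set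
  App3 f x y z v = Σ A λ u → App2 f x y u × App u z v

  App4 : A → A → A → A → A → A → Set
  App4 f x y z w v = Σ A λ u → App3 f x y z u × App u w v

  field
    two      : Σ A λ x → Σ A λ y → x ≢ y
    k s      : A
    k-ax     : ∀ a b → App2 k a b a
    s-def    : ∀ a b → Σ A λ v → App2 s a b v
    s-ax     : ∀ a b c v →
               App3 s a b c v ⇔ (Σ A λ x → Σ A λ y → App a c x × App b c y × App x y v)
    num      : ℕ → A
    succ pred d : A
    succ-ax  : ∀ n → App succ (num n) (num (suc n))
    pred-ax  : ∀ n → App pred (num (suc n)) (num n)
    d-eq     : ∀ n m a b → n ≡ m → App4 d (num n) (num m) a b a
    d-neq    : ∀ n m a b → n ≢ m → App4 d (num n) (num m) a b b
    p p₀ p₁  : A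
    p-ax     : ∀ a₀ a₁ → Σ A λ c → App2 p a₀ a₁ c × App p₀ c a₀ × App p₁ c a₁

  pair : A → A → A
  pair a b = proj₁ (p-ax a b)

  𝟎 𝟏 : A
  𝟎 = num 0
  𝟏 = num 1

  cN : ℕ → A
  cN n = pair (num 0) (num n)
  cNat : A
  cNat = pair (num 1) 𝟎
  cPi cSig cW : A → A → A
  cPi a b  = pair (num 2) (pair a b)
  cSig a b = pair (num 3) (pair a b)
  cW a b   = pair (num 5) (pair a b)
  cI : A → A → A → A
  cI c a b = pair (num 4) (pair c (pair a b))

-- The ΠΣI type structure (flag false) / ΠΣWI type structure (flag true),
-- as an inductive–recursive definition of  σ ∼ τ  and  El e = ∼_σ
-- (where e : σ ∼ τ).

module TypeStructure (P : PCA) (withW : Bool) where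
  open PCA P

  -- The least relation W such that  c W d  whenever  c₀ R d₀  (via h) and
  -- c₁ q W d₁ r  for all  q (Q h) r.  (Used for ∼_{W_σ i}, with R = ∼_σ and
  -- Q h = ∼_{i c₀}.)
  data WRel (R : A → A → Set) (Q : ∀ {a b} → R a b → A → A → Set) : A → A → Set where
    wsup : ∀ {c d c₀ d₀ c₁ d₁} →
           App p₀ c c₀ → App p₀ d d₀ → App p₁ c c₁ → App p₁ d d₁ →
           (h : R c₀ d₀) →
           (∀ q r → Q h q r →
              Σ A λ u → Σ A λ v → App c₁ q u × App d₁ r v × WRel R Q u v) →
           WRel R Q c d

  mutual
    data _∼_ : A → A → Set where
      nN  : (n : ℕ) → cN n ∼ cN n
      nat : cNat ∼ cNat
      pi  : ∀ {σ τ i j} (e : σ ∼ τ) →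
            (∀ a b → El e a b → FamAt i j a b) → cPi σ i ∼ cPi τ j
      sg  : ∀ {σ τ i j} (e : σ ∼ τ) →
            (∀ a b → El e a b → FamAt i j a b) → cSig σ i ∼ cSig τ j
      idt : ∀ {σ τ a a' b b'} (e : σ ∼ τ) → El e a a' → El e b b' →
            cI σ a b ∼ cI τ a' b'
      wt  : T withW → ∀ {σ τ i j} (e : σ ∼ τ) →
            (∀ a b → El e a b → FamAt i j a b) → cW σ i ∼ cW τ j

    data FamAt (i j a b : A) : Set where
      fam : ∀ {c d} → App i a c → App j b d → c ∼ d → FamAt i j a b

    ElF : ∀ {i j a b} → FamAt i j a b → A → A → Set
    ElF (fam _ _ e) = El e

    El : ∀ {σ τ} → σ ∼ τ → A → A → Set
    El (nN n) a b = Σ ℕ λ m → m < n × a ≡ num m × b ≡ num m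
    El nat a b = Σ ℕ λ m → a ≡ num m × b ≡ num m
    El (pi e fm) f g = ∀ a b → (h : El e a b) →
      Σ A λ u → Σ A λ v → App f a u × App g b v × ElF (fm a b h) u v
    El (sg e fm) a b = Σ A λ a₀ → Σ A λ b₀ → Σ A λ a₁ → Σ A λ b₁ →
      App p₀ a a₀ × App p₀ b b₀ × App p₁ a a₁ × App p₁ b b₁ ×
      Σ (El e a₀ b₀) λ h → ElF (fm a₀ b₀ h) a₁ b₁
    El (idt {a = a} {b = b} e _ _) c d = c ≡ 𝟎 × d ≡ 𝟎 × El e a b
    El (wt _ e fm) = WRel (El e) (λ {a} {b} h → ElF (fm a b h))

-- V_ext(A): Aczel-style iterative sets whose elements are triples
-- ⟨a , b , x⟩ with a b ∈ A and x ∈ V_ext(A); extensional equality _≐_.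

module Vext (P : PCA) where
  open PCA P

  data V : Set₁ where
    sup : (I : Set) → (I → A × A × V) → V

  mutual
    _≐_ : V → V → Set
    sup I f ≐ sup J g =
      (∀ x → Σ J λ y → f x ≐₃ g y) × (∀ y → Σ I λ x → f x ≐₃ g y)

    _≐₃_ : A × A × V → A × A × V → Set
    (a , b , x) ≐₃ (a' , b' , y) = a ≡ a' × b ≡ b' × x ≐ y

  emptyV : V
  emptyV = sup ⊥ ⊥-elim

  sing : V → V
  sing x = sup ⊤ (λ _ → 𝟎 , 𝟎 , x)

  upair : V → V → V
  upair x y = sup Bool (λ { true → 𝟎 , 𝟎 , x ; false → 𝟏 , 𝟏 , y })

  opair : V → V → V
  opair x y = sup Bool (λ { true → 𝟎 , 𝟎 , sing x ; false → 𝟏 , 𝟏 , upair x y })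

  dot : ℕ → V
  dot = <-rec (λ _ → V)
    (λ n rec → sup (Σ ℕ λ m → m < n) (λ { (m , m<n) → num m , num m , rec {m} m<n }))

module Interpretation (P : PCA) (withW : Bool) where
  open PCA P
  open TypeStructure P withW
  open Vext P

  -- For e : σ ∼ τ and h : a ∼_σ b,  ⟦ e ⟧ h  is  a^σ
  -- (computed from the left-hand components a, σ throughout).
  mutual
    ⟦_⟧ : ∀ {σ τ a b} (e : σ ∼ τ) → El e a b → V
    ⟦ nN n ⟧ (m , _ , _ , _) = dot m
    ⟦ nat ⟧ (m , _ , _) = dot m
    ⟦ pi e fm ⟧ h = sup (Σ A λ a → Σ A λ b → El e a b)
      (λ { (a , b , h') → a , b ,
           opair (⟦ e ⟧ h') (⟦ fm a b h' ⟧F (proj₂ (proj₂ (proj₂ (proj₂ (h a b h')))))) })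
    ⟦ sg e fm ⟧ (a₀ , b₀ , a₁ , b₁ , _ , _ , _ , _ , h₀ , h₁) =
      opair (⟦ e ⟧ h₀) (⟦ fm a₀ b₀ h₀ ⟧F h₁)
    ⟦ idt e _ _ ⟧ _ = emptyV
    ⟦ wt _ e fm ⟧ w = ⟦ e , fm ⟧W w

    ⟦_⟧F : ∀ {i j a b u v} (x : FamAt i j a b) → ElF x u v → V
    ⟦ fam _ _ e ⟧F h = ⟦ e ⟧ h

    ⟦_,_⟧W : ∀ {σ τ i j} (e : σ ∼ τ) (fm : ∀ a b → El e a b → FamAt i j a b)
             {c d} → WRel (El e) (λ {a} {b} h → ElF (fm a b h)) c d → V
    ⟦ e , fm ⟧W (wsup {c₀ = c₀} {d₀ = d₀} _ _ _ _ h k) =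
      opair (⟦ e ⟧ h)
        (sup (Σ A λ q → Σ A λ r → ElF (fm c₀ d₀ h) q r)
          (λ { (q , r , hq) → q , r ,
               opair (⟦ fm c₀ d₀ h ⟧F hq)
                     (⟦ e , fm ⟧W (proj₂ (proj₂ (proj₂ (proj₂ (k q r hq)))))) }))

  X : ∀ {σ τ} → σ ∼ τ → V
  X e = sup (Σ A λ a → Σ A λ b → El e a b) (λ { (a , b , h) → a , b , ⟦ e ⟧ h })

  XF : ∀ {i j a b} → FamAt i j a b → V
  XF (fam _ _ e) = X e

  F : ∀ {σ τ i j} (e : σ ∼ τ) → (∀ a b → El e a b → FamAt i j a b) → V
  F e fm = sup (Σ A λ a → Σ A λ b → El e a b)
    (λ { (a , b , h) → a , b , opair (⟦ e ⟧ h) (XF (fm a b h)) })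

-- Call σ₁ ∼ τ₁ and σ₂ ∼ τ₂ linked when σ₁ ≡ σ₂ or τ₁ ≡ τ₂. By simultaneous induction on
-- derivations, each ∼_σ is a partial equivalence relation, and both ∼_σ and a^σ are the same
-- for linked derivations: a shared side fixes the outermost rule (through the tag of the
-- code), the premises are linked again, and a shared i or j forces the same values i a or j b.
-- The identity type is the one case needing the PER laws: sharing only τ, a′ and b′, the
-- relation a ∼ b must be carried over through a′ and b′. The theorem then chains two links,
-- σ ∼ σ with σ ∼ τ on the left and σ ∼ τ with τ ∼ τ on the right.
module Submission where

open import Defs
open import Data.Nat using (ℕ)
open import Data.Nat.Properties using (_≟_)
open import Data.Bool using (Bool; true; false)
open import Data.Unit using (tt)
open import Data.Empty using (⊥-elim)
open import Data.Product using (Σ; ∃; _×_; _,_; proj₁; proj₂; uncurry)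
open import Data.Product.Properties using (,-injectiveˡ; ,-injectiveʳ)
open import Data.Sum using (_⊎_; inj₁; inj₂)
import Data.Sum as Sum
open import Function using (_∘_; flip)
open import Relation.Nullary using (yes; no)
open import Relation.Binary.Core using (_⇒_)
open import Relation.Binary.Definitions using (Symmetric; Transitive)
open import Relation.Binary.PropositionalEquality
  using (_≡_; refl; sym; trans; subst; cong; cong₂)

Linked : {X : Set} → X → X → X → X → Set
Linked x₁ y₁ x₂ y₂ = x₁ ≡ x₂ ⊎ y₁ ≡ y₂

Linked-sym : {X : Set} {x₁ y₁ x₂ y₂ : X} → Linked x₁ y₁ x₂ y₂ → Linked x₂ y₂ x₁ y₁
Linked-sym = Sum.map sym sym

Linked-map : {X Y : Set} (f g : X → Y) {x₁ y₁ x₂ y₂ : X} →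
             Linked x₁ y₁ x₂ y₂ → Linked (f x₁) (g y₁) (f x₂) (g y₂)
Linked-map f g = Sum.map (cong f) (cong g)

module PCAProperties (P : PCA) where
  open PCA P

  App2-func : ∀ {f x y v w} → App2 f x y v → App2 f x y w → v ≡ w
  App2-func (_ , fx , fxy) (_ , fx′ , fxy′) with App-func fx fx′
  ... | refl = App-func fxy fxy′

  App3-func : ∀ {f x y z v w} → App3 f x y z v → App3 f x y z w → v ≡ w
  App3-func (_ , fxy , fxyz) (_ , fxy′ , fxyz′) with App2-func fxy fxy′
  ... | refl = App-func fxyz fxyz′

  App4-func : ∀ {f x y z t v w} → App4 f x y z t v → App4 f x y z t w → v ≡ w
  App4-func (_ , fxyz , fxyzt) (_ , fxyz′ , fxyzt′) with App3-func fxyz fxyz′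
  ... | refl = App-func fxyzt fxyzt′

  -- d n̄ m̄ separates the two distinct elements of A unless n = m.
  num-injective : ∀ {n m} → num n ≡ num m → n ≡ m
  num-injective {n} {m} eq with n ≟ m | two
  ... | yes n≡m | _ = n≡m
  ... | no n≢m | x , y , x≢y =
    ⊥-elim (x≢y (App4-func (d-eq n n x y refl)
                           (subst (λ z → App4 d (num n) z x y y) (sym eq) (d-neq n m x y n≢m))))

  pair-injective : ∀ {a b a′ b′} → pair a b ≡ pair a′ b′ → (a , b) ≡ (a′ , b′)
  pair-injective {a} {b} {a′} {b′} eq with p-ax a b | p-ax a′ b′
  ... | c , _ , p₀c , p₁c | c′ , _ , p₀c′ , p₁c′ = cong₂ _,_
    (App-func (subst (λ z → App p₀ z a) eq p₀c) p₀c′)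
    (App-func (subst (λ z → App p₁ z b) eq p₁c) p₁c′)

  HasTag : ℕ → A → Set
  HasTag k σ = ∃ λ r → σ ≡ pair (num k) r

  HasTag-unique : ∀ {k k′ σ} → HasTag k σ → HasTag k′ σ → k ≡ k′
  HasTag-unique (_ , refl) (_ , eq) = num-injective (,-injectiveˡ (pair-injective eq))

  body-injective : ∀ {k x y x′ y′} →
                   pair (num k) (pair x y) ≡ pair (num k) (pair x′ y′) → (x , y) ≡ (x′ , y′)
  body-injective = pair-injective ∘ ,-injectiveʳ ∘ pair-injective

  cN-injective : ∀ {n n′} → cN n ≡ cN n′ → n ≡ n′
  cN-injective = num-injective ∘ ,-injectiveʳ ∘ pair-injective

  cI-injective : ∀ {c a b c′ a′ b′} → cI c a b ≡ cI c′ a′ b′ → (c , a , b) ≡ (c′ , a′ , b′)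
  cI-injective eq = cong₂ _,_ (,-injectiveˡ eq′) (pair-injective (,-injectiveʳ eq′))
    where eq′ = body-injective eq

  AppRel : (A → A → Set) → A → A → A → A → Set
  AppRel R f a g b = Σ A λ u → Σ A λ v → App f a u × App g b v × R u v

  related : ∀ {R f a g b} (r : AppRel R f a g b) → R (proj₁ r) (proj₁ (proj₂ r))
  related (_ , _ , _ , _ , r) = r

  AppRel-map : ∀ {R S f a g b} → R ⇒ S → AppRel R f a g b → AppRel S f a g b
  AppRel-map R⇒S (u , v , fa , gb , r) = u , v , fa , gb , R⇒S r

  AppRel-swap : ∀ {R f a g b} → AppRel R f a g b → AppRel (flip R) g b f a
  AppRel-swap (u , v , fa , gb , r) = v , u , gb , fa , r

  AppRel-trans : ∀ {R S T f a g b h c} → (∀ {u v w} → R u v → S v w → T u w) →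
                 AppRel R f a g b → AppRel S g b h c → AppRel T f a h c
  AppRel-trans compose (u , v , fa , gb , r) (v′ , w , gb′ , hc , s) with App-func gb gb′
  ... | refl = u , w , fa , hc , compose r s

  AppRel-related₂ : ∀ {R S f a g b} (Φ : ∀ {u v u′ v′} → R u v → S u′ v′ → Set) →
                    (∀ {u v} (r : R u v) (s : S u v) → Φ r s) →
                    (r : AppRel R f a g b) (s : AppRel S f a g b) → Φ (related r) (related s)
  AppRel-related₂ Φ φ (_ , _ , fa , gb , r) (_ , _ , fa′ , gb′ , s)
    with App-func fa fa′ | App-func gb gb′
  ... | refl | refl = φ r s

module VextProperties (P : PCA) where
  open PCA P
  open Vext P

  mutual
    ≐-refl : ∀ x → x ≐ x
    ≐-refl (sup I f) = (λ i → i , ≐₃-refl (f i)) , (λ i → i , ≐₃-refl (f i))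

    ≐₃-refl : ∀ s → s ≐₃ s
    ≐₃-refl (a , b , x) = refl , refl , ≐-refl x

  mutual
    ≐-trans : ∀ {x y z} → x ≐ y → y ≐ z → x ≐ z
    ≐-trans {sup I f} {sup J g} {sup K h} (f⊆g , g⊆f) (g⊆h , h⊆g) =
      (λ i → let (j , fi≐gj) = f⊆g i ; (k , gj≐hk) = g⊆h j
             in k , ≐₃-trans (f i) (g j) (h k) fi≐gj gj≐hk) ,
      (λ k → let (j , gj≐hk) = h⊆g k ; (i , fi≐gj) = g⊆f j
             in i , ≐₃-trans (f i) (g j) (h k) fi≐gj gj≐hk)

    ≐₃-trans : ∀ s t u → s ≐₃ t → t ≐₃ u → s ≐₃ u
    ≐₃-trans _ _ _ (refl , refl , x≐y) (refl , refl , y≐z) = refl , refl , ≐-trans x≐y y≐z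

  sing-cong : ∀ {x y} → x ≐ y → sing x ≐ sing y
  sing-cong x≐y = (λ _ → tt , refl , refl , x≐y) , (λ _ → tt , refl , refl , x≐y)

  upair-cong : ∀ {x x′ y y′} → x ≐ x′ → y ≐ y′ → upair x y ≐ upair x′ y′
  upair-cong x≐x′ y≐y′ =
    (λ { true → true , refl , refl , x≐x′ ; false → false , refl , refl , y≐y′ }) ,
    (λ { true → true , refl , refl , x≐x′ ; false → false , refl , refl , y≐y′ })

  opair-cong : ∀ {x x′ y y′} → x ≐ x′ → y ≐ y′ → opair x y ≐ opair x′ y′
  opair-cong x≐x′ y≐y′ =
    (λ { true  → true , refl , refl , sing-cong x≐x′
       ; false → false , refl , refl , upair-cong x≐x′ y≐y′ }) ,
    (λ { true  → true , refl , refl , sing-cong x≐x′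
       ; false → false , refl , refl , upair-cong x≐x′ y≐y′ })

  triples : (R : A → A → Set) → (∀ {a b} → R a b → V) → V
  triples R G = sup (Σ A λ a → Σ A λ b → R a b) (λ { (a , b , h) → a , b , G h })

  triples-cong : ∀ {R S : A → A → Set} {G : ∀ {a b} → R a b → V} {H : ∀ {a b} → S a b → V} →
                 (R⇒S : R ⇒ S) (S⇒R : S ⇒ R) → (∀ {a b} (r : R a b) (s : S a b) → G r ≐ H s) →
                 triples R G ≐ triples S H
  triples-cong R⇒S S⇒R G≐H =
    (λ { (a , b , r) → (a , b , R⇒S r) , refl , refl , G≐H r (R⇒S r) }) ,
    (λ { (a , b , s) → (a , b , S⇒R s) , refl , refl , G≐H (S⇒R s) s })

module TypeStructureProperties (P : PCA) (withW : Bool) where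
  open PCA P
  open TypeStructure P withW
  open Vext P
  open Interpretation P withW
  open PCAProperties P
  open VextProperties P

  Family : ∀ {σ τ} → σ ∼ τ → A → A → Set
  Family e i j = ∀ a b → El e a b → FamAt i j a b

  -- Subtrees are destructured explicitly, not passed through AppRel-map or AppRel-trans,
  -- so that the recursion stays visibly structural.
  module _ {R : A → A → Set} {Q : ∀ {a b} → R a b → A → A → Set} where

    WRel-map : ∀ {R′ : A → A → Set} {Q′ : ∀ {a b} → R′ a b → A → A → Set} →
               (R⇒R′ : R ⇒ R′) → (∀ {a b} (h : R a b) → Q′ (R⇒R′ h) ⇒ Q h) → WRel R Q ⇒ WRel R′ Q′
    WRel-map R⇒R′ Q′⇒Q (wsup p₀c p₀d p₁c p₁d h k) = wsup p₀c p₀d p₁c p₁d (R⇒R′ h) λ q r hq →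
      let (u , v , c₁q , d₁r , w) = k q r (Q′⇒Q h hq) in u , v , c₁q , d₁r , WRel-map R⇒R′ Q′⇒Q w

    WRel-sym : (sym-R : Symmetric R) → (∀ {a b} (h : R a b) {q r} → Q (sym-R h) q r → Q h r q) →
               Symmetric (WRel R Q)
    WRel-sym sym-R flip-Q (wsup p₀c p₀d p₁c p₁d h k) = wsup p₀d p₀c p₁d p₁c (sym-R h) λ q r hq →
      let (u , v , c₁r , d₁q , w) = k r q (flip-Q h hq) in v , u , d₁q , c₁r , WRel-sym sym-R flip-Q w

    WRel-trans : (trans-R : Transitive R) →
                 (∀ {a b c} (h : R a b) (h′ : R b c) → Q (trans-R h h′) ⇒ Q h) →
                 (∀ {a b c} (h : R a b) (h′ : R b c) {q r} → Q (trans-R h h′) q r → Q h′ r r) →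
                 Transitive (WRel R Q)
    WRel-trans trans-R left diag (wsup p₀c p₀d p₁c p₁d h k) (wsup p₀d′ p₀e p₁d′ p₁e h′ k′)
      with App-func p₀d p₀d′ | App-func p₁d p₁d′
    ... | refl | refl = wsup p₀c p₀e p₁c p₁e (trans-R h h′) λ q r hq →
      compose (k q r (left h h′ hq)) (k′ r r (diag h h′ hq))
      where
      compose : ∀ {f₁ f₂ f₃ q r} → AppRel (WRel R Q) f₁ q f₂ r → AppRel (WRel R Q) f₂ r f₃ r →
                AppRel (WRel R Q) f₁ q f₃ r
      compose (u , v , f₁q , f₂r , w) (_ , x , f₂r′ , f₃r , w′) with App-func f₂r f₂r′
      ... | refl = u , x , f₁q , f₃r , WRel-trans trans-R left diag w w′

  tag : ∀ {σ τ} → σ ∼ τ → ℕ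
  tag (nN _)      = 0
  tag nat         = 1
  tag (pi _ _)    = 2
  tag (sg _ _)    = 3
  tag (idt _ _ _) = 4
  tag (wt _ _ _)  = 5

  tag-codes : ∀ {σ τ} (e : σ ∼ τ) → HasTag (tag e) σ × HasTag (tag e) τ
  tag-codes (nN _)      = (_ , refl) , (_ , refl)
  tag-codes nat         = (_ , refl) , (_ , refl)
  tag-codes (pi _ _)    = (_ , refl) , (_ , refl)
  tag-codes (sg _ _)    = (_ , refl) , (_ , refl)
  tag-codes (idt _ _ _) = (_ , refl) , (_ , refl)
  tag-codes (wt _ _ _)  = (_ , refl) , (_ , refl)

  tag-linked : ∀ {σ₁ τ₁ σ₂ τ₂} (e₁ : σ₁ ∼ τ₁) (e₂ : σ₂ ∼ τ₂) → Linked σ₁ τ₁ σ₂ τ₂ → tag e₁ ≡ tag e₂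
  tag-linked e₁ e₂ (inj₁ refl) = HasTag-unique (proj₁ (tag-codes e₁)) (proj₁ (tag-codes e₂))
  tag-linked e₁ e₂ (inj₂ refl) = HasTag-unique (proj₂ (tag-codes e₁)) (proj₂ (tag-codes e₂))

  -- Matching on  Form (tag e₁) e₂  lets unification rule out the rules of e₂ that differ from e₁'s.
  data Form : ∀ {σ τ} → ℕ → σ ∼ τ → Set where
    nN  : ∀ {n} → Form 0 (nN n)
    nat : Form 1 nat
    pi  : ∀ {σ τ i j} {e : σ ∼ τ} {fm : Family e i j} → Form 2 (pi e fm)
    sg  : ∀ {σ τ i j} {e : σ ∼ τ} {fm : Family e i j} → Form 3 (sg e fm)
    idt : ∀ {σ τ a a′ b b′} {e : σ ∼ τ} {ea : El e a a′} {eb : El e b b′} → Form 4 (idt e ea eb)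
    wt  : ∀ {w σ τ i j} {e : σ ∼ τ} {fm : Family e i j} → Form 5 (wt w e fm)

  form : ∀ {σ τ} (e : σ ∼ τ) → Form (tag e) e
  form (nN _)      = nN
  form nat         = nat
  form (pi _ _)    = pi
  form (sg _ _)    = sg
  form (idt _ _ _) = idt
  form (wt _ _ _)  = wt

  data Compatible : ∀ {σ₁ τ₁ σ₂ τ₂} → σ₁ ∼ τ₁ → σ₂ ∼ τ₂ → Set where
    nN  : ∀ {n} → Compatible (nN n) (nN n)
    nat : Compatible nat nat
    pi  : ∀ {σ τ i j σ′ τ′ i′ j′} {e : σ ∼ τ} {e′ : σ′ ∼ τ′}
            {fm : Family e i j} {fm′ : Family e′ i′ j′} →
          Linked σ τ σ′ τ′ → Linked i j i′ j′ → Compatible (pi e fm) (pi e′ fm′)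
    sg  : ∀ {σ τ i j σ′ τ′ i′ j′} {e : σ ∼ τ} {e′ : σ′ ∼ τ′}
            {fm : Family e i j} {fm′ : Family e′ i′ j′} →
          Linked σ τ σ′ τ′ → Linked i j i′ j′ → Compatible (sg e fm) (sg e′ fm′)
    idt : ∀ {σ τ a a′ b b′ σ₂ τ₂ a₂ a₂′ b₂ b₂′} {e : σ ∼ τ} {e₂ : σ₂ ∼ τ₂}
            {ea : El e a a′} {eb : El e b b′} {ea₂ : El e₂ a₂ a₂′} {eb₂ : El e₂ b₂ b₂′} →
          Linked (σ , a , b) (τ , a′ , b′) (σ₂ , a₂ , b₂) (τ₂ , a₂′ , b₂′) →
          Compatible (idt e ea eb) (idt e₂ ea₂ eb₂)
    wt  : ∀ {w w′ σ τ i j σ′ τ′ i′ j′} {e : σ ∼ τ} {e′ : σ′ ∼ τ′}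
            {fm : Family e i j} {fm′ : Family e′ i′ j′} →
          Linked σ τ σ′ τ′ → Linked i j i′ j′ → Compatible (wt w e fm) (wt w′ e′ fm′)

  compatible : ∀ {σ₁ τ₁ σ₂ τ₂} (e₁ : σ₁ ∼ τ₁) (e₂ : σ₂ ∼ τ₂) → Linked σ₁ τ₁ σ₂ τ₂ → Compatible e₁ e₂
  compatible e₁ e₂ l = by-form e₁ e₂ (subst (λ k → Form k e₂) (sym (tag-linked e₁ e₂ l)) (form e₂)) l
    where
    premises : ∀ {k σ i τ j σ′ i′ τ′ j′} →
               Linked (pair (num k) (pair σ i)) (pair (num k) (pair τ j))
                      (pair (num k) (pair σ′ i′)) (pair (num k) (pair τ′ j′)) →
               Linked σ τ σ′ τ′ × Linked i j i′ j′
    premises l = Linked-map proj₁ proj₁ l′ , Linked-map proj₂ proj₂ l′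
      where l′ = Sum.map body-injective body-injective l

    by-form : ∀ {σ₁ τ₁ σ₂ τ₂} (e₁ : σ₁ ∼ τ₁) (e₂ : σ₂ ∼ τ₂) →
              Form (tag e₁) e₂ → Linked σ₁ τ₁ σ₂ τ₂ → Compatible e₁ e₂
    by-form (nN n) (nN n′) nN l with Sum.[ cN-injective , cN-injective ]′ l
    ... | refl = nN
    by-form nat nat nat _ = nat
    by-form (pi _ _) (pi _ _) pi l = uncurry pi (premises l)
    by-form (sg _ _) (sg _ _) sg l = uncurry sg (premises l)
    by-form (idt _ _ _) (idt _ _ _) idt l = idt (Sum.map cI-injective cI-injective l)
    by-form (wt _ _ _) (wt _ _ _) wt l = uncurry wt (premises l)

  Linked-args : ∀ {i j i′ j′ a b : A} → Linked i j i′ j′ → Linked (i , a) (j , b) (i′ , a) (j′ , b)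
  Linked-args {a = a} {b} = Linked-map (_, a) (_, b)

  mutual
    El-linked : ∀ {σ₁ τ₁ σ₂ τ₂} (e₁ : σ₁ ∼ τ₁) (e₂ : σ₂ ∼ τ₂) → Linked σ₁ τ₁ σ₂ τ₂ → El e₁ ⇒ El e₂
    El-linked e₁ e₂ l = El-compatible e₁ e₂ (compatible e₁ e₂ l)

    El-compatible : ∀ {σ₁ τ₁ σ₂ τ₂} (e₁ : σ₁ ∼ τ₁) (e₂ : σ₂ ∼ τ₂) → Compatible e₁ e₂ → El e₁ ⇒ El e₂
    El-compatible (nN _) (nN _) nN h = h
    El-compatible nat nat nat h = h
    El-compatible (pi e fm) (pi e′ fm′) (pi l fl) h a b h′ =
      AppRel-map (ElF-linked (fm a b h″) (fm′ a b h′) (Linked-args fl)) (h a b h″)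
      where h″ = El-linked e′ e (Linked-sym l) h′
    El-compatible (sg e fm) (sg e′ fm′) (sg l fl)
                  (a₀ , b₀ , a₁ , b₁ , p₀a , p₀b , p₁a , p₁b , h₀ , h₁) =
      a₀ , b₀ , a₁ , b₁ , p₀a , p₀b , p₁a , p₁b , h₀′ ,
      ElF-linked (fm a₀ b₀ h₀) (fm′ a₀ b₀ h₀′) (Linked-args fl) h₁
      where h₀′ = El-linked e e′ l h₀
    El-compatible (idt e _ _) (idt e′ _ _) (idt (inj₁ refl)) (c≡𝟎 , d≡𝟎 , h) =
      c≡𝟎 , d≡𝟎 , El-linked e e′ (inj₁ refl) h
    El-compatible (idt e ea eb) (idt e′ ea′ eb′) (idt (inj₂ refl)) (c≡𝟎 , d≡𝟎 , h) =
      c≡𝟎 , d≡𝟎 , El-linked e e′ (inj₂ refl)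
        (a₂∼a′ ⨾ El-sym e ea ⨾ h ⨾ eb ⨾ El-sym e b₂∼b′)
      where
      _⨾_ = El-trans e
      infixr 5 _⨾_
      a₂∼a′ = El-linked e′ e (inj₂ refl) ea′
      b₂∼b′ = El-linked e′ e (inj₂ refl) eb′
    El-compatible (wt _ e fm) (wt _ e′ fm′) (wt l fl) =
      WRel-map (El-linked e e′ l)
               (λ h → ElF-linked (fm′ _ _ (El-linked e e′ l h)) (fm _ _ h)
                                 (Linked-args (Linked-sym fl)))

    ElF-linked : ∀ {i₁ j₁ a₁ b₁ i₂ j₂ a₂ b₂} (x₁ : FamAt i₁ j₁ a₁ b₁) (x₂ : FamAt i₂ j₂ a₂ b₂) →
                 Linked (i₁ , a₁) (j₁ , b₁) (i₂ , a₂) (j₂ , b₂) → ElF x₁ ⇒ ElF x₂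
    ElF-linked (fam ia₁ _ d₁) (fam ia₂ _ d₂) (inj₁ refl) = El-linked d₁ d₂ (inj₁ (App-func ia₁ ia₂))
    ElF-linked (fam _ jb₁ d₁) (fam _ jb₂ d₂) (inj₂ refl) = El-linked d₁ d₂ (inj₂ (App-func jb₁ jb₂))

    -- fm a b and fm a b′ agree on i a, and fm a b′ and fm a′ b′ agree on j b′.
    ElF-reindex : ∀ {σ τ i j} (e : σ ∼ τ) (fm : Family e i j) {a b a′ b′ h h′} →
                  El e a b′ → ElF (fm a b h) ⇒ ElF (fm a′ b′ h′)
    ElF-reindex e fm {a} {b} {a′} {b′} {h} {h′} ab′ =
      ElF-linked (fm a b′ ab′) (fm a′ b′ h′) (inj₂ refl) ∘
      ElF-linked (fm a b h) (fm a b′ ab′) (inj₁ refl)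

    El-sym : ∀ {σ τ} (e : σ ∼ τ) → Symmetric (El e)
    El-sym (nN _) (m , m<n , a≡ , b≡) = m , m<n , b≡ , a≡
    El-sym nat (m , a≡ , b≡) = m , b≡ , a≡
    El-sym (pi e fm) h a b ab =
      AppRel-map (ElF-reindex e fm (El-trans e ba ab) ∘ ElF-sym (fm b a ba)) (AppRel-swap (h b a ba))
      where ba = El-sym e ab
    El-sym (sg e fm) (a₀ , b₀ , a₁ , b₁ , p₀a , p₀b , p₁a , p₁b , h₀ , h₁) =
      b₀ , a₀ , b₁ , a₁ , p₀b , p₀a , p₁b , p₁a , El-sym e h₀ ,
      ElF-reindex e fm (El-trans e h₀ (El-sym e h₀)) (ElF-sym (fm a₀ b₀ h₀) h₁)
    El-sym (idt _ _ _) (c≡𝟎 , d≡𝟎 , h) = d≡𝟎 , c≡𝟎 , h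
    El-sym (wt _ e fm) = WRel-sym (El-sym e)
      (λ h → ElF-reindex e fm (El-trans e (El-sym e h) h) ∘ ElF-sym (fm _ _ (El-sym e h)))

    El-trans : ∀ {σ τ} (e : σ ∼ τ) → Transitive (El e)
    El-trans (nN _) (m , m<n , a≡ , b≡) (_ , _ , b≡′ , c≡) =
      m , m<n , a≡ , trans c≡ (trans (sym b≡′) b≡)
    El-trans nat (m , a≡ , b≡) (_ , b≡′ , c≡) = m , a≡ , trans c≡ (trans (sym b≡′) b≡)
    El-trans (pi e fm) h₁ h₂ a b ab = AppRel-trans
      (λ r s → ElF-trans (fm a b ab) r (ElF-linked (fm b b bb) (fm a b ab) (inj₂ refl) s))
      (h₁ a b ab) (h₂ b b bb)
      where bb = El-trans e (El-sym e ab) ab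
    El-trans (sg e fm) (a₀ , b₀ , a₁ , b₁ , p₀a , p₀b , p₁a , p₁b , ab₀ , ab₁)
                       (_ , c₀ , _ , c₁ , p₀b′ , p₀c , p₁b′ , p₁c , bc₀ , bc₁)
      with App-func p₀b p₀b′ | App-func p₁b p₁b′
    ... | refl | refl =
      a₀ , c₀ , a₁ , c₁ , p₀a , p₀c , p₁a , p₁c , ac₀ ,
      ElF-trans (fm a₀ c₀ ac₀) (ElF-linked (fm a₀ b₀ ab₀) (fm a₀ c₀ ac₀) (inj₁ refl) ab₁)
                               (ElF-linked (fm b₀ c₀ bc₀) (fm a₀ c₀ ac₀) (inj₂ refl) bc₁)
      where ac₀ = El-trans e ab₀ bc₀
    El-trans (idt _ _ _) (c≡𝟎 , _ , h) (_ , d≡𝟎 , _) = c≡𝟎 , d≡𝟎 , h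
    El-trans (wt _ e fm) = WRel-trans (El-trans e)
      (λ h h′ → ElF-linked (fm _ _ (El-trans e h h′)) (fm _ _ h) (inj₁ refl))
      (λ h h′ hq → let qr = ElF-linked (fm _ _ (El-trans e h h′)) (fm _ _ h′) (inj₂ refl) hq
                   in ElF-trans (fm _ _ h′) (ElF-sym (fm _ _ h′) qr) qr)

    ElF-sym : ∀ {i j a b} (x : FamAt i j a b) → Symmetric (ElF x)
    ElF-sym (fam _ _ d) = El-sym d

    ElF-trans : ∀ {i j a b} (x : FamAt i j a b) → Transitive (ElF x)
    ElF-trans (fam _ _ d) = El-trans d

  mutual
    ⟦⟧-linked : ∀ {σ₁ τ₁ σ₂ τ₂} (e₁ : σ₁ ∼ τ₁) (e₂ : σ₂ ∼ τ₂) → Linked σ₁ τ₁ σ₂ τ₂ →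
                ∀ {a b} (h₁ : El e₁ a b) (h₂ : El e₂ a b) → ⟦ e₁ ⟧ h₁ ≐ ⟦ e₂ ⟧ h₂
    ⟦⟧-linked e₁ e₂ l = ⟦⟧-compatible e₁ e₂ (compatible e₁ e₂ l)

    ⟦⟧-compatible : ∀ {σ₁ τ₁ σ₂ τ₂} (e₁ : σ₁ ∼ τ₁) (e₂ : σ₂ ∼ τ₂) → Compatible e₁ e₂ →
                    ∀ {a b} (h₁ : El e₁ a b) (h₂ : El e₂ a b) → ⟦ e₁ ⟧ h₁ ≐ ⟦ e₂ ⟧ h₂
    ⟦⟧-compatible (nN _) (nN _) nN (m , _ , refl , _) (m′ , _ , m≡m′ , _) with num-injective m≡m′
    ... | refl = ≐-refl (dot m)
    ⟦⟧-compatible nat nat nat (m , refl , _) (m′ , m≡m′ , _) with num-injective m≡m′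
    ... | refl = ≐-refl (dot m)
    ⟦⟧-compatible (pi e fm) (pi e′ fm′) (pi l fl) f g =
      triples-cong (El-linked e e′ l) (El-linked e′ e (Linked-sym l)) λ {a} {b} h h′ →
        opair-cong (⟦⟧-linked e e′ l h h′)
          (AppRel-related₂ (λ r s → ⟦ fm a b h ⟧F r ≐ ⟦ fm′ a b h′ ⟧F s)
                           (⟦⟧F-linked (fm a b h) (fm′ a b h′) (Linked-args fl)) (f a b h) (g a b h′))
    ⟦⟧-compatible (sg e fm) (sg e′ fm′) (sg l fl)
                  (a₀ , b₀ , a₁ , b₁ , p₀a , p₀b , p₁a , p₁b , h₀ , h₁)
                  (_ , _ , _ , _ , p₀a′ , p₀b′ , p₁a′ , p₁b′ , h₀′ , h₁′)
      with App-func p₀a p₀a′ | App-func p₀b p₀b′ | App-func p₁a p₁a′ | App-func p₁b p₁b′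
    ... | refl | refl | refl | refl =
      opair-cong (⟦⟧-linked e e′ l h₀ h₀′)
                 (⟦⟧F-linked (fm a₀ b₀ h₀) (fm′ a₀ b₀ h₀′) (Linked-args fl) h₁ h₁′)
    ⟦⟧-compatible (idt _ _ _) (idt _ _ _) (idt _) _ _ = (λ ()) , (λ ())
    ⟦⟧-compatible (wt _ e fm) (wt _ e′ fm′) (wt l fl) = ⟦⟧W-linked
      where
      ⟦⟧W-linked : ∀ {c d} (w₁ : WRel (El e) (λ {a} {b} h → ElF (fm a b h)) c d)
                           (w₂ : WRel (El e′) (λ {a} {b} h → ElF (fm′ a b h)) c d) →
                   ⟦ e , fm ⟧W w₁ ≐ ⟦ e′ , fm′ ⟧W w₂
      ⟦⟧W-linked (wsup {c₀ = c₀} {d₀} p₀c p₀d p₁c p₁d h k) (wsup p₀c′ p₀d′ p₁c′ p₁d′ h′ k′)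
        with App-func p₀c p₀c′ | App-func p₀d p₀d′ | App-func p₁c p₁c′ | App-func p₁d p₁d′
      ... | refl | refl | refl | refl =
        opair-cong (⟦⟧-linked e e′ l h h′)
          (triples-cong (ElF-linked (fm c₀ d₀ h) (fm′ c₀ d₀ h′) (Linked-args fl))
                        (ElF-linked (fm′ c₀ d₀ h′) (fm c₀ d₀ h) (Linked-args (Linked-sym fl)))
                        λ {q} {r} hq hq′ →
            opair-cong (⟦⟧F-linked (fm c₀ d₀ h) (fm′ c₀ d₀ h′) (Linked-args fl) hq hq′)
                       (subtrees (k q r hq) (k′ q r hq′)))
        where
        subtrees : ∀ {f q g r}
                   (t₁ : AppRel (WRel (El e) (λ {a} {b} h → ElF (fm a b h))) f q g r)
                   (t₂ : AppRel (WRel (El e′) (λ {a} {b} h → ElF (fm′ a b h))) f q g r) →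
                   ⟦ e , fm ⟧W (related t₁) ≐ ⟦ e′ , fm′ ⟧W (related t₂)
        subtrees (_ , _ , fq , gr , w₁) (_ , _ , fq′ , gr′ , w₂) with App-func fq fq′ | App-func gr gr′
        ... | refl | refl = ⟦⟧W-linked w₁ w₂

    ⟦⟧F-linked : ∀ {i₁ j₁ a₁ b₁ i₂ j₂ a₂ b₂ u v} (x₁ : FamAt i₁ j₁ a₁ b₁) (x₂ : FamAt i₂ j₂ a₂ b₂) →
                 Linked (i₁ , a₁) (j₁ , b₁) (i₂ , a₂) (j₂ , b₂) →
                 (r₁ : ElF x₁ u v) (r₂ : ElF x₂ u v) → ⟦ x₁ ⟧F r₁ ≐ ⟦ x₂ ⟧F r₂
    ⟦⟧F-linked (fam ia₁ _ d₁) (fam ia₂ _ d₂) (inj₁ refl) = ⟦⟧-linked d₁ d₂ (inj₁ (App-func ia₁ ia₂))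
    ⟦⟧F-linked (fam _ jb₁ d₁) (fam _ jb₂ d₂) (inj₂ refl) = ⟦⟧-linked d₁ d₂ (inj₂ (App-func jb₁ jb₂))

  X-linked : ∀ {σ₁ τ₁ σ₂ τ₂} (e₁ : σ₁ ∼ τ₁) (e₂ : σ₂ ∼ τ₂) → Linked σ₁ τ₁ σ₂ τ₂ → X e₁ ≐ X e₂
  X-linked e₁ e₂ l =
    triples-cong (El-linked e₁ e₂ l) (El-linked e₂ e₁ (Linked-sym l)) (⟦⟧-linked e₁ e₂ l)

  XF-linked : ∀ {i₁ j₁ i₂ j₂ a b} (x₁ : FamAt i₁ j₁ a b) (x₂ : FamAt i₂ j₂ a b) →
              Linked i₁ j₁ i₂ j₂ → XF x₁ ≐ XF x₂
  XF-linked (fam ia₁ _ d₁) (fam ia₂ _ d₂) (inj₁ refl) = X-linked d₁ d₂ (inj₁ (App-func ia₁ ia₂))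
  XF-linked (fam _ jb₁ d₁) (fam _ jb₂ d₂) (inj₂ refl) = X-linked d₁ d₂ (inj₂ (App-func jb₁ jb₂))

  F-linked : ∀ {σ₁ τ₁ σ₂ τ₂ i₁ j₁ i₂ j₂} (e₁ : σ₁ ∼ τ₁) (e₂ : σ₂ ∼ τ₂) → Linked σ₁ τ₁ σ₂ τ₂ →
             (fm₁ : Family e₁ i₁ j₁) (fm₂ : Family e₂ i₂ j₂) → Linked i₁ j₁ i₂ j₂ →
             F e₁ fm₁ ≐ F e₂ fm₂
  F-linked e₁ e₂ l fm₁ fm₂ fl =
    triples-cong (El-linked e₁ e₂ l) (El-linked e₂ e₁ (Linked-sym l)) λ {a} {b} h₁ h₂ →
      opair-cong (⟦⟧-linked e₁ e₂ l h₁ h₂) (XF-linked (fm₁ a b h₁) (fm₂ a b h₂) fl)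

lemma4p13 : (P : PCA) (withW : Bool) →
    let open PCA P
        open TypeStructure P withW
        open Vext P
        open Interpretation P withW
    in ∀ {σ τ i j} (e : σ ∼ τ) →
       (i≈j : ∀ a b → El e a b → FamAt i j a b) →
       (dσ : σ ∼ σ) (dτ : τ ∼ τ) →
       (famᵢ : ∀ a b → El dσ a b → FamAt i i a b) →
       (famⱼ : ∀ a b → El dτ a b → FamAt j j a b) →
       (X dσ ≐ X dτ) × (F dσ famᵢ ≐ F dτ famⱼ)
lemma4p13 P withW e i≈j dσ dτ famᵢ famⱼ =
  ≐-trans (X-linked dσ e (inj₁ refl)) (X-linked e dτ (inj₂ refl)) ,
  ≐-trans (F-linked dσ e (inj₁ refl) famᵢ i≈j (inj₁ refl))
          (F-linked e dτ (inj₂ refl) i≈j famⱼ (inj₂ refl))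
  where
  open VextProperties P
  open TypeStructureProperties P withW
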